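{- Let $\mathfrak A$ and $\mathfrak E$ be finite symmetric integral relation algebras such that $\mathfrak A$ is a special extension of $\mathfrak E$. For every $n\in\omega$ let $B_n=\{1'\}\cup\{x^{(i)}: x\text{ a diversity atom of }\mathfrak A,\ i<n\}\cup\{J(a,n): a\text{ a diversity atom of }\mathfrak E\}$. Then the set of all joins (unions) of subsets of $B_n$ is a subalgebra of $\mathfrak C_{\mathfrak E}(\mathfrak A)$ whose set of atoms is exactly $B_n$.
   Context: Relation algebras are symmetric and integral; $0'=\overline{1'}$. $\mathfrak A$ is a special extension of $\mathfrak E$ if $\mathfrak E\subseteq\mathfrak A$ and for all diversity atoms $a,b,c$ of $\mathfrak E$: (1) if not $a=b=c$ and $a;b\ge c$, then $x;y\ge c$ for all atoms $x\le a$, $y\le b$ of $\mathfrak A$; (2) if $a;a\ge a$, then $x;y\cdot a\ne0$ for all atoms $x,y\le a$ of $\mathfrak A$. For an atom $x$ of $\mathfrak A$, $c(x)$ is the atom of $\mathfrak E$ above $x$. $T(i,j,k)$ iff $(i\le j=k)$ or $(j\le k=i)$ or $(k\le i=j)$. $\mathrm{At}=\{1'\}\cup\{x^{(i)}:x\text{ diversity atom of }\mathfrak A,\ i\in\omega\}$; $Cy\subseteq\mathrm{At}^3$ consists of all permutations of $(1',1',1')$, $(1',x^{(i)},x^{(i)})$, and $(x^{(i)},y^{(j)},z^{(k)})$ whenever $x,y,z$ are diversity atoms of $\mathfrak A$ with $x;y\ge z$ and ($c(x)=c(y)=c(z)\Rightarrow T(i,j,k)$). $\mathfrak C_{\mathfrak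 E}(\mathfrak A)$ is the complex algebra on the power set of $\mathrm{At}$ with set Boolean operations, identity $\{1'\}$, identity converse, $X;Y=\{w:\exists u\in X,v\in Y,(u,v,w)\in Cy\}$; atoms identified with singletons. $J(a,n)=\{x^{(i)}:x\text{ diversity atom of }\mathfrak A,\ x\le a,\ n\le i\}\cup\{1':1'\le a\}$. -}

module Defs where

open import Level using (0ℓ)
open import Data.Nat using (ℕ; _≤_; _<_)
open import Data.Fin using (Fin)
open import Data.Bool using (Bool; true)
open import Data.Maybe using (Maybe; just; nothing)
open import Data.Product using (Σ; ∃; ∃-syntax; _×_; _,_)
open import Data.Sum using (_⊎_)
open import Data.Unit using (⊤)
open import Data.Empty using (⊥)
open import Relation.Nullary using (¬_)
open import Relation.Binary.PropositionalEquality using (_≡_)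
open import Function.Bundles using (_↔_)
open import Function.Definitions using (Injective)
open import Algebra.Core using (Op₁; Op₂)
open import Algebra.Lattice.Structures using (IsBooleanAlgebra)

record RelAlg : Set₁ where
  infixr 6 _∨_
  infixr 7 _∧_
  infixr 8 _⨾_
  field
    Carrier : Set
    _∨_ _∧_ : Op₂ Carrier
    -_      : Op₁ Carrier
    ⊤' ⊥'   : Carrier
    _⨾_     : Op₂ Carrier
    _˘      : Op₁ Carrier
    1'      : Carrier
    isBooleanAlgebra : IsBooleanAlgebra _≡_ _∨_ _∧_ -_ ⊤' ⊥'
    ⨾-assoc     : ∀ x y z → (x ⨾ y) ⨾ z ≡ x ⨾ (y ⨾ z)
    ⨾-distribʳ  : ∀ x y z → (x ∨ y) ⨾ z ≡ (x ⨾ z) ∨ (y ⨾ z)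
    ⨾-identityʳ : ∀ x → x ⨾ 1' ≡ x
    ˘-involutive : ∀ x → (x ˘) ˘ ≡ x
    ˘-distrib   : ∀ x y → (x ∨ y) ˘ ≡ (x ˘) ∨ (y ˘)
    ˘-⨾         : ∀ x y → (x ⨾ y) ˘ ≡ (y ˘) ⨾ (x ˘)
    tarski      : ∀ x y → ((x ˘) ⨾ (- (x ⨾ y))) ∨ (- y) ≡ - y

  _≼_ : Carrier → Carrier → Set
  x ≼ y = x ∨ y ≡ y

  0' : Carrier
  0' = - 1'

  IsAtom : Carrier → Set
  IsAtom x = ¬ (x ≡ ⊥') × (∀ y → y ≼ x → (y ≡ ⊥') ⊎ (y ≡ x))

  DivAtom : Carrier → Set
  DivAtom x = IsAtom x × x ≼ 0'

Finite : RelAlg → Set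
Finite R = Σ ℕ λ m → Fin m ↔ RelAlg.Carrier R

Symmetric : RelAlg → Set
Symmetric R = ∀ x → x ˘ ≡ x
  where open RelAlg R

Integral : RelAlg → Set
Integral R = IsAtom 1'
  where open RelAlg R

record IsHom (E A : RelAlg) (h : RelAlg.Carrier E → RelAlg.Carrier A) : Set where
  private
    module E = RelAlg E
    module A = RelAlg A
  field
    ∨-hom : ∀ x y → h (x E.∨ y) ≡ h x A.∨ h y
    ¬-hom : ∀ x → h (E.- x) ≡ A.- (h x)
    ⨾-hom : ∀ x y → h (x E.⨾ y) ≡ h x A.⨾ h y
    ˘-hom : ∀ x → h (x E.˘) ≡ (h x) A.˘
    1'-hom : h E.1' ≡ A.1'

-- E ⊆ A is given by an injective homomorphism ι : E → A (a subalgebra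
-- embedding); elements of E are identified with their images.
record Embedding (E A : RelAlg) : Set where
  field
    ι     : RelAlg.Carrier E → RelAlg.Carrier A
    isHom : IsHom E A ι
    inj   : Injective _≡_ _≡_ ι

module Ext (A E : RelAlg) (emb : Embedding E A) where
  private
    module A = RelAlg A
    module E = RelAlg E
  open Embedding emb

  record IsSpecial : Set where
    field
      cond1 : ∀ a b c → E.DivAtom a → E.DivAtom b → E.DivAtom c →
              ¬ (a ≡ b × b ≡ c) → c E.≼ (a E.⨾ b) →
              ∀ x y → A.IsAtom x → A.IsAtom y → x A.≼ ι a → y A.≼ ι b →
              ι c A.≼ (x A.⨾ y)
      cond2 : ∀ a → E.DivAtom a → a E.≼ (a E.⨾ a) →
              ∀ x y → A.IsAtom x → A.IsAtom y → x A.≼ ι a → y A.≼ ι a →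
              ¬ (((x A.⨾ y) A.∧ ι a) ≡ A.⊥')

  -- "a = c(x)": a is the atom of 𝔈 above the atom x of 𝔄
  IsC : A.Carrier → E.Carrier → Set
  IsC x a = E.IsAtom a × x A.≼ ι a

  SameC : A.Carrier → A.Carrier → A.Carrier → Set
  SameC x y z = ∃[ a ] (IsC x a × IsC y a × IsC z a)

  T : ℕ → ℕ → ℕ → Set
  T i j k = (i ≤ j × j ≡ k) ⊎ (j ≤ k × k ≡ i) ⊎ (k ≤ i × i ≡ j)

  -- The atoms At: nothing = 1', just (x , i) = x^(i) (for x a diversity atom)
  At : Set
  At = Maybe (A.Carrier × ℕ)

  ValidAt : At → Set
  ValidAt nothing = ⊤
  ValidAt (just (x , i)) = A.DivAtom x

  data Base : At → At → At → Set where
    ididid : Base nothing nothing nothing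
    idxx   : ∀ x i → A.DivAtom x → Base nothing (just (x , i)) (just (x , i))
    xyz    : ∀ x i y j z k → A.DivAtom x → A.DivAtom y → A.DivAtom z →
             z A.≼ (x A.⨾ y) → (SameC x y z → T i j k) →
             Base (just (x , i)) (just (y , j)) (just (z , k))

  Cy : At → At → At → Set
  Cy u v w = Base u v w ⊎ Base u w v ⊎ Base v u w ⊎ Base v w u
           ⊎ Base w u v ⊎ Base w v u

  -- The complex algebra ℭ_𝔈(𝔄): subsets of At
  Sub : Set₁
  Sub = At → Set

  _⊆_ : Sub → Sub → Set
  X ⊆ Y = ∀ w → X w → Y w

  _≈_ : Sub → Sub → Set
  X ≈ Y = (X ⊆ Y) × (Y ⊆ X)

  ∅ : Sub
  ∅ _ = ⊥

  _∪_ : Sub → Sub → Sub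
  (X ∪ Y) w = X w ⊎ Y w

  ∼_ : Sub → Sub
  (∼ X) w = ValidAt w × ¬ X w

  idC : Sub
  idC w = w ≡ nothing

  convC : Sub → Sub
  convC X = X

  _⨾C_ : Sub → Sub → Sub
  (X ⨾C Y) w = ∃[ u ] ∃[ v ] (X u × Y v × Cy u v w)

  sing : A.Carrier → ℕ → Sub
  sing x i w = w ≡ just (x , i)

  J : E.Carrier → ℕ → Sub
  J a n w = (∃[ x ] ∃[ i ] (w ≡ just (x , i) × A.DivAtom x × x A.≼ ι a × n ≤ i))
          ⊎ (w ≡ nothing × E.1' E.≼ a)

  BIdx : Set
  BIdx = ⊤ ⊎ (A.Carrier × ℕ) ⊎ E.Carrier

  ValidIdx : ℕ → BIdx → Set
  ValidIdx n (Data.Sum.inj₁ _) = ⊤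
  ValidIdx n (Data.Sum.inj₂ (Data.Sum.inj₁ (x , i))) = A.DivAtom x × i < n
  ValidIdx n (Data.Sum.inj₂ (Data.Sum.inj₂ a)) = E.DivAtom a

  elt : ℕ → BIdx → Sub
  elt n (Data.Sum.inj₁ _) = idC
  elt n (Data.Sum.inj₂ (Data.Sum.inj₁ (x , i))) = sing x i
  elt n (Data.Sum.inj₂ (Data.Sum.inj₂ a)) = J a n

  InB : ℕ → Sub → Set
  InB n Z = ∃[ k ] (ValidIdx n k × Z ≈ elt n k)

  ⋃ : ℕ → (BIdx → Bool) → Sub
  ⋃ n S w = ∃[ k ] (S k ≡ true × elt n k w)

  Joins : ℕ → Sub → Set
  Joins n Z = ∃[ S ] ((∀ k → S k ≡ true → ValidIdx n k) × Z ≈ ⋃ n S)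

  record IsSubalgebra (𝒮 : Sub → Set) : Set₁ where
    field
      respects : ∀ {X Y} → X ≈ Y → 𝒮 X → 𝒮 Y
      id-closed   : 𝒮 idC
      ∪-closed    : ∀ {X Y} → 𝒮 X → 𝒮 Y → 𝒮 (X ∪ Y)
      ∼-closed    : ∀ {X} → 𝒮 X → 𝒮 (∼ X)
      ⨾-closed    : ∀ {X Y} → 𝒮 X → 𝒮 Y → 𝒮 (X ⨾C Y)
      conv-closed : ∀ {X} → 𝒮 X → 𝒮 (convC X)

  AtomOf : (Sub → Set) → Sub → Set₁
  AtomOf 𝒮 Z = 𝒮 Z × ¬ (Z ≈ ∅) ×
               (∀ W → 𝒮 W → W ⊆ Z → (W ≈ ∅) ⊎ (W ≈ Z))

module Submission where

-- The sets in B_n partition the atoms of ℭ_𝔈(𝔄): 1', the copies x^(i) with i < n, and, for each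
-- diversity atom a of 𝔈, the tail J(a, n). Joins of the blocks of a partition are closed under union
-- and complement and have exactly the blocks as atoms, so what remains is that the composite of two
-- blocks is a union of blocks: whether an atom lies in it depends only on the atom's block. As c is
-- constant on a tail, this comes down to conditions in 𝔈, plus one realisation property supplied by
-- 𝔄 being special: a cycle b ≤ c(x);c(z) of 𝔈 has an atom y ≤ b with z ≤ x;y, by condition (1), or
-- by (2) when c(x) = c(z) = b. The index condition T is met by giving new copies large indices, and
-- it fails exactly where two low copies would compose into a tail, or a low copy and a tail into a
-- low copy. Finiteness makes "block k lies in the composite" decidable, as joins require.

open import Defs
open import Data.Nat using (ℕ)
open import Data.Product using (_×_)

open import Level using (0ℓ)
open import Function using (id; _∘_)
open import Function.Bundles using (Inverse)
open import Data.Nat using (_≤_; _<_; _<?_; _⊔_)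
open import Data.Nat.Properties as ℕₚ
  using (≤-refl; ≤-trans; <⇒≤; ≮⇒≥; <-irrefl; ≤⇒≯; <-≤-trans; m≤m⊔n; m≤n⊔m)
open import Data.Fin using (Fin; toℕ; fromℕ<)
open import Data.Fin.Properties using (any?; all?; toℕ-fromℕ<) renaming (_≟_ to _≟ᶠ_)
open import Data.Bool using (true)
open import Data.Bool.Properties using () renaming (_≟_ to _≟𝔹_)
open import Data.Unit using (⊤; tt)
import Data.Unit.Properties as ⊤
open import Data.Maybe using (just; nothing)
open import Data.Product using (∃; ∃-syntax; _,_; proj₁; proj₂)
import Data.Product.Properties as Σ
open import Data.Sum using (_⊎_; inj₁; inj₂)
import Data.Sum.Properties as ⊎
open import Data.Empty using (⊥; ⊥-elim)
open import Data.List using (List; []; _∷_; map; allFin)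
open import Data.List.Membership.Propositional using (_∈_)
open import Data.List.Membership.Propositional.Properties using (∈-map⁺; ∈-allFin)
open import Data.List.Relation.Unary.Any using (here; there)
open import Relation.Nullary using (¬_; Dec; yes; no; does)
open import Relation.Nullary.Decidable using (_×-dec_; _⊎-dec_; _→-dec_; ¬?; map′; dec-true)
open import Relation.Binary.Definitions using (DecidableEquality)
open import Relation.Binary.PropositionalEquality
  using (_≡_; _≢_; refl; sym; trans; cong; cong₂; subst; subst₂; module ≡-Reasoning)
open import Algebra.Lattice.Bundles using (BooleanAlgebra)
open import Algebra.Lattice.Structures using (IsBooleanAlgebra)

module BooleanOrder (R : RelAlg) where
  open RelAlg R
  open IsBooleanAlgebra isBooleanAlgebra
    using (∨-comm; ∨-assoc; ∧-comm; ∧-assoc; ∨-absorbs-∧; ∧-absorbs-∨;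
           ∧-distribˡ-∨; ∨-complementʳ; ∧-complementʳ)
  open ≡-Reasoning

  booleanAlgebra : BooleanAlgebra 0ℓ 0ℓ
  booleanAlgebra = record
    { Carrier = Carrier ; _≈_ = _≡_ ; _∨_ = _∨_ ; _∧_ = _∧_ ; ¬_ = -_
    ; ⊤ = ⊤' ; ⊥ = ⊥' ; isBooleanAlgebra = isBooleanAlgebra }

  open import Algebra.Lattice.Properties.BooleanAlgebra booleanAlgebra public
    using (¬-involutive; deMorgan₂; ∨-identityˡ; ∨-identityʳ; ∨-zeroʳ; ∧-identityʳ; ∨-idem; ∧-idem)

  ∧≡¬∨¬ : ∀ x y → x ∧ y ≡ - ((- x) ∨ (- y))
  ∧≡¬∨¬ x y = sym (trans (deMorgan₂ (- x) (- y)) (cong₂ _∧_ (¬-involutive x) (¬-involutive y)))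

  ≼-refl : ∀ {x} → x ≼ x
  ≼-refl = ∨-idem _

  ≼-trans : ∀ {x y z} → x ≼ y → y ≼ z → x ≼ z
  ≼-trans {x} {y} {z} x≼y y≼z = begin
    x ∨ z        ≡⟨ cong (x ∨_) (sym y≼z) ⟩
    x ∨ (y ∨ z)  ≡⟨ sym (∨-assoc x y z) ⟩
    (x ∨ y) ∨ z  ≡⟨ cong (_∨ z) x≼y ⟩
    y ∨ z        ≡⟨ y≼z ⟩
    z            ∎

  ≼-antisym : ∀ {x y} → x ≼ y → y ≼ x → x ≡ y
  ≼-antisym {x} {y} x≼y y≼x = trans (sym y≼x) (trans (∨-comm y x) x≼y)

  ≼⇒∧≡ : ∀ {x y} → x ≼ y → x ∧ y ≡ x
  ≼⇒∧≡ {x} {y} x≼y = trans (cong (x ∧_) (sym x≼y)) (∧-absorbs-∨ x y)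

  ∧≡⇒≼ : ∀ {x y} → x ∧ y ≡ x → x ≼ y
  ∧≡⇒≼ {x} {y} x∧y≡x = begin
    x ∨ y        ≡⟨ cong (_∨ y) (sym x∧y≡x) ⟩
    (x ∧ y) ∨ y  ≡⟨ ∨-comm (x ∧ y) y ⟩
    y ∨ (x ∧ y)  ≡⟨ cong (y ∨_) (∧-comm x y) ⟩
    y ∨ (y ∧ x)  ≡⟨ ∨-absorbs-∧ y x ⟩
    y            ∎

  x∧y≼x : ∀ {x y} → (x ∧ y) ≼ x
  x∧y≼x {x} {y} = ∧≡⇒≼ (begin
    (x ∧ y) ∧ x  ≡⟨ ∧-comm (x ∧ y) x ⟩
    x ∧ (x ∧ y)  ≡⟨ sym (∧-assoc x x y) ⟩
    (x ∧ x) ∧ y  ≡⟨ cong (_∧ y) (∧-idem x) ⟩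
    x ∧ y        ∎)

  x∧y≼y : ∀ {x y} → (x ∧ y) ≼ y
  x∧y≼y {x} {y} = ∧≡⇒≼ (trans (∧-assoc x y y) (cong (x ∧_) (∧-idem y)))

  ∧-greatest : ∀ {x y z} → z ≼ x → z ≼ y → z ≼ (x ∧ y)
  ∧-greatest {x} {y} {z} z≼x z≼y =
    ∧≡⇒≼ (trans (sym (∧-assoc z x y)) (trans (cong (_∧ y) (≼⇒∧≡ z≼x)) (≼⇒∧≡ z≼y)))

  x≼⊤ : ∀ {x} → x ≼ ⊤'
  x≼⊤ {x} = ∨-zeroʳ x

  x≼⊥⇒x≡⊥ : ∀ {x} → x ≼ ⊥' → x ≡ ⊥'
  x≼⊥⇒x≡⊥ {x} x≼⊥ = trans (sym (∨-identityʳ x)) x≼⊥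

  x≼y⇒x≼¬y⇒x≡⊥ : ∀ {x y} → x ≼ y → x ≼ (- y) → x ≡ ⊥'
  x≼y⇒x≼¬y⇒x≡⊥ {x} {y} x≼y x≼¬y =
    x≼⊥⇒x≡⊥ (subst (x ≼_) (∧-complementʳ y) (∧-greatest x≼y x≼¬y))

  ∧-split : ∀ x e → x ≡ (x ∧ e) ∨ (x ∧ (- e))
  ∧-split x e = sym (begin
    (x ∧ e) ∨ (x ∧ (- e))  ≡⟨ sym (∧-distribˡ-∨ x e (- e)) ⟩
    x ∧ (e ∨ (- e))        ≡⟨ cong (x ∧_) (∨-complementʳ e) ⟩
    x ∧ ⊤'                 ≡⟨ ∧-identityʳ x ⟩
    x                      ∎)

  atom-≼⊎≼¬ : ∀ {x} → IsAtom x → ∀ e → (x ≼ e) ⊎ (x ≼ (- e))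
  atom-≼⊎≼¬ {x} (_ , minimal) e with minimal (x ∧ e) x∧y≼x
  ... | inj₂ x∧e≡x = inj₁ (∧≡⇒≼ x∧e≡x)
  ... | inj₁ x∧e≡⊥ = inj₂ (∧≡⇒≼ (sym (begin
    x                        ≡⟨ ∧-split x e ⟩
    (x ∧ e) ∨ (x ∧ (- e))    ≡⟨ cong (_∨ (x ∧ (- e))) x∧e≡⊥ ⟩
    ⊥' ∨ (x ∧ (- e))         ≡⟨ ∨-identityˡ _ ⟩
    x ∧ (- e)                ∎)))

  atom-≼-≢⊥⇒≡ : ∀ {x y} → IsAtom x → y ≼ x → y ≢ ⊥' → y ≡ x
  atom-≼-≢⊥⇒≡ (_ , minimal) y≼x y≢⊥ with minimal _ y≼x
  ... | inj₁ y≡⊥ = ⊥-elim (y≢⊥ y≡⊥)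
  ... | inj₂ y≡x = y≡x

module FiniteBooleanOrder (R : RelAlg) (finite : Finite R) where
  open RelAlg R
  open BooleanOrder R
  open Inverse (proj₂ finite) using (to; from; strictlyInverseˡ)
  open ≡-Reasoning

  _≟_ : DecidableEquality Carrier
  x ≟ y = map′ from-injective (cong from) (from x ≟ᶠ from y)
    where
      from-injective : from x ≡ from y → x ≡ y
      from-injective eq = trans (sym (strictlyInverseˡ x)) (trans (cong to eq) (strictlyInverseˡ y))

  _≼?_ : ∀ x y → Dec (x ≼ y)
  x ≼? y = (x ∨ y) ≟ y

  ∀? : {P : Carrier → Set} → (∀ x → Dec (P x)) → Dec (∀ x → P x)
  ∀? {P} P? = map′ (λ ∀i x → subst P (strictlyInverseˡ x) (∀i (from x))) (λ ∀x i → ∀x (to i))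
                   (all? (P? ∘ to))

  ∃? : {P : Carrier → Set} → (∀ x → Dec (P x)) → Dec (∃ P)
  ∃? {P} P? = map′ (λ (i , p) → to i , p) (λ (x , p) → from x , subst P (sym (strictlyInverseˡ x)) p)
                   (any? (P? ∘ to))

  IsAtom? : ∀ x → Dec (IsAtom x)
  IsAtom? x = ¬? (x ≟ ⊥') ×-dec ∀? (λ y → (y ≼? x) →-dec ((y ≟ ⊥') ⊎-dec (y ≟ x)))

  elements : List Carrier
  elements = map to (allFin _)

  ∈-elements : ∀ x → x ∈ elements
  ∈-elements x = subst (_∈ elements) (strictlyInverseˡ x) (∈-map⁺ to (∈-allFin (from x)))

  module _ (G : Carrier → Set) (G⇒≢⊥ : ∀ {z} → G z → z ≢ ⊥')
           (G-split : ∀ {z} e → G z → G (z ∧ e) ⊎ G (z ∧ (- e))) where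

    -- Cutting successively along every element of the finite algebra ends in an atom.
    private
      refine : ∀ es {z} → G z → ∃[ a ] (G a × a ≼ z × (∀ {e} → e ∈ es → (a ≼ e) ⊎ (a ≼ (- e))))
      refine [] g = _ , g , ≼-refl , λ ()
      refine (e ∷ es) g with G-split e g
      ... | inj₁ g′ = let a , ga , a≼ , sides = refine es g′ in
        a , ga , ≼-trans a≼ x∧y≼x ,
        λ { (here refl) → inj₁ (≼-trans a≼ x∧y≼y) ; (there e∈) → sides e∈ }
      ... | inj₂ g′ = let a , ga , a≼ , sides = refine es g′ in
        a , ga , ≼-trans a≼ x∧y≼x ,
        λ { (here refl) → inj₂ (≼-trans a≼ x∧y≼y) ; (there e∈) → sides e∈ }

    atom-below : ∀ {z} → G z → ∃[ a ] (IsAtom a × a ≼ z × G a)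
    atom-below g with refine elements g
    ... | a , ga , a≼z , sides = a , (G⇒≢⊥ ga , minimal) , a≼z , ga
      where
        minimal : ∀ y → y ≼ a → (y ≡ ⊥') ⊎ (y ≡ a)
        minimal y y≼a with sides (∈-elements y)
        ... | inj₁ a≼y = inj₂ (≼-antisym y≼a a≼y)
        ... | inj₂ a≼¬y = inj₁ (x≼y⇒x≼¬y⇒x≡⊥ ≼-refl (≼-trans y≼a a≼¬y))

  ≢⊥-split : ∀ {z} e → z ≢ ⊥' → (z ∧ e) ≢ ⊥' ⊎ (z ∧ (- e)) ≢ ⊥'
  ≢⊥-split {z} e z≢⊥ with (z ∧ e) ≟ ⊥'
  ... | no z∧e≢⊥ = inj₁ z∧e≢⊥
  ... | yes z∧e≡⊥ = inj₂ λ z∧¬e≡⊥ → z≢⊥ (begin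
    z                      ≡⟨ ∧-split z e ⟩
    (z ∧ e) ∨ (z ∧ (- e))  ≡⟨ cong₂ _∨_ z∧e≡⊥ z∧¬e≡⊥ ⟩
    ⊥' ∨ ⊥'                ≡⟨ ∨-identityˡ ⊥' ⟩
    ⊥'                     ∎)

  nonzero⇒atom-below : ∀ {z} → z ≢ ⊥' → ∃[ a ] (IsAtom a × a ≼ z)
  nonzero⇒atom-below z≢⊥ =
    let a , atom , a≼z , _ = atom-below (_≢ ⊥') id ≢⊥-split z≢⊥ in a , atom , a≼z

module SymmetricRelAlg (R : RelAlg) (symmetric : Symmetric R) where
  open RelAlg R
  open BooleanOrder R
  open ≡-Reasoning

  ⨾-comm : ∀ x y → x ⨾ y ≡ y ⨾ x
  ⨾-comm x y = begin
    x ⨾ y          ≡⟨ sym (symmetric (x ⨾ y)) ⟩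
    (x ⨾ y) ˘      ≡⟨ ˘-⨾ x y ⟩
    (y ˘) ⨾ (x ˘)  ≡⟨ cong₂ _⨾_ (symmetric y) (symmetric x) ⟩
    y ⨾ x          ∎

  ⨾-monoˡ : ∀ {x x′ y} → x ≼ x′ → (x ⨾ y) ≼ (x′ ⨾ y)
  ⨾-monoˡ {x} {x′} {y} x≼x′ = trans (sym (⨾-distribʳ x x′ y)) (cong (_⨾ y) x≼x′)

  ⨾-mono : ∀ {x x′ y y′} → x ≼ x′ → y ≼ y′ → (x ⨾ y) ≼ (x′ ⨾ y′)
  ⨾-mono {x} {x′} {y} {y′} x≼x′ y≼y′ =
    ≼-trans (⨾-monoˡ x≼x′) (subst₂ _≼_ (⨾-comm y x′) (⨾-comm y′ x′) (⨾-monoˡ y≼y′))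

  ⨾-¬⨾-≼¬ : ∀ x y → (x ⨾ (- (x ⨾ y))) ≼ (- y)
  ⨾-¬⨾-≼¬ x y = subst (λ t → (t ⨾ (- (x ⨾ y))) ≼ (- y)) (symmetric x) (tarski x y)

  ≼⨾-cycle : ∀ {x y z} → IsAtom y → IsAtom z → y ≼ (x ⨾ z) → z ≼ (x ⨾ y)
  ≼⨾-cycle {x} {y} {z} y-atom z-atom y≼x⨾z with atom-≼⊎≼¬ z-atom (x ⨾ y)
  ... | inj₁ z≼x⨾y = z≼x⨾y
  ... | inj₂ z≼¬x⨾y = ⊥-elim (proj₁ y-atom (x≼y⇒x≼¬y⇒x≡⊥ ≼-refl
          (≼-trans y≼x⨾z (≼-trans (⨾-mono ≼-refl z≼¬x⨾y) (⨾-¬⨾-≼¬ x y)))))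

module EmbeddingProperties (E A : RelAlg) (emb : Embedding E A) where
  private
    module A = RelAlg A
    module E = RelAlg E
    module OA = BooleanOrder A
    module OE = BooleanOrder E
    module BA = IsBooleanAlgebra A.isBooleanAlgebra
    module BE = IsBooleanAlgebra E.isBooleanAlgebra
  open Embedding emb
  open IsHom isHom
  open ≡-Reasoning

  ι-mono : ∀ {x y} → x E.≼ y → ι x A.≼ ι y
  ι-mono {x} {y} x≼y = trans (sym (∨-hom x y)) (cong ι x≼y)

  ι-∧ : ∀ x y → ι (x E.∧ y) ≡ ι x A.∧ ι y
  ι-∧ x y = begin
    ι (x E.∧ y)                            ≡⟨ cong ι (OE.∧≡¬∨¬ x y) ⟩
    ι (E.- ((E.- x) E.∨ (E.- y)))          ≡⟨ ¬-hom _ ⟩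
    A.- ι ((E.- x) E.∨ (E.- y))            ≡⟨ cong A.-_ (∨-hom _ _) ⟩
    A.- (ι (E.- x) A.∨ ι (E.- y))          ≡⟨ cong A.-_ (cong₂ A._∨_ (¬-hom x) (¬-hom y)) ⟩
    A.- ((A.- ι x) A.∨ (A.- ι y))          ≡⟨ sym (OA.∧≡¬∨¬ (ι x) (ι y)) ⟩
    ι x A.∧ ι y                            ∎

  ι-⊥ : ι E.⊥' ≡ A.⊥'
  ι-⊥ = begin
    ι E.⊥'                      ≡⟨ cong ι (sym (BE.∧-complementʳ E.⊥')) ⟩
    ι (E.⊥' E.∧ (E.- E.⊥'))     ≡⟨ ι-∧ _ _ ⟩
    ι E.⊥' A.∧ ι (E.- E.⊥')     ≡⟨ cong (ι E.⊥' A.∧_) (¬-hom _) ⟩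
    ι E.⊥' A.∧ (A.- ι E.⊥')     ≡⟨ BA.∧-complementʳ _ ⟩
    A.⊥'                        ∎

  ι-⊤ : ι E.⊤' ≡ A.⊤'
  ι-⊤ = begin
    ι E.⊤'                      ≡⟨ cong ι (sym (BE.∨-complementʳ E.⊥')) ⟩
    ι (E.⊥' E.∨ (E.- E.⊥'))     ≡⟨ ∨-hom _ _ ⟩
    ι E.⊥' A.∨ ι (E.- E.⊥')     ≡⟨ cong (ι E.⊥' A.∨_) (¬-hom _) ⟩
    ι E.⊥' A.∨ (A.- ι E.⊥')     ≡⟨ BA.∨-complementʳ _ ⟩
    A.⊤'                        ∎

  ι-0' : ι E.0' ≡ A.0'
  ι-0' = trans (¬-hom E.1') (cong A.-_ 1'-hom)

  ι-≢⊥ : ∀ {a} → a ≢ E.⊥' → ι a ≢ A.⊥'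
  ι-≢⊥ a≢⊥ ιa≡⊥ = a≢⊥ (inj (trans ιa≡⊥ (sym ι-⊥)))

  overlap⇒atom≼ : ∀ {c d z} → E.IsAtom c → z ≢ A.⊥' → z A.≼ ι c → z A.≼ ι d → c E.≼ d
  overlap⇒atom≼ {c} {d} c-atom z≢⊥ z≼ιc z≼ιd with OE.atom-≼⊎≼¬ c-atom d
  ... | inj₁ c≼d = c≼d
  ... | inj₂ c≼¬d = ⊥-elim (z≢⊥ (OA.x≼y⇒x≼¬y⇒x≡⊥ z≼ιd
          (OA.≼-trans z≼ιc (subst (ι c A.≼_) (¬-hom d) (ι-mono c≼¬d)))))

  overlap⇒atom≡ : ∀ {a b z} → E.IsAtom a → E.IsAtom b → z ≢ A.⊥' →
                  z A.≼ ι a → z A.≼ ι b → a ≡ b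
  overlap⇒atom≡ a-atom b-atom z≢⊥ z≼ιa z≼ιb =
    OE.atom-≼-≢⊥⇒≡ b-atom (overlap⇒atom≼ a-atom z≢⊥ z≼ιa z≼ιb) (proj₁ a-atom)

pattern idᴮ = inj₁ tt
pattern atᴮ x i = inj₂ (inj₁ (x , i))
pattern Jᴮ a = inj₂ (inj₂ a)

module Extension (A E : RelAlg) (finA : Finite A) (finE : Finite E)
                 (symA : Symmetric A) (symE : Symmetric E) (intE : Integral E)
                 (emb : Embedding E A) where
  private
    module A = RelAlg A
    module E = RelAlg E
    module OA = BooleanOrder A
    module OE = BooleanOrder E
    module FA = FiniteBooleanOrder A finA
    module FE = FiniteBooleanOrder E finE
    module SA = SymmetricRelAlg A symA
    module SE = SymmetricRelAlg E symE
  open Ext A E emb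
  open Embedding emb
  open IsHom isHom
  open EmbeddingProperties E A emb

  IsC? : ∀ x a → Dec (IsC x a)
  IsC? x a = FE.IsAtom? a ×-dec (x FA.≼? ι a)

  atom-above : ∀ {x} → A.IsAtom x → ∃ (IsC x)
  atom-above {x} x-atom =
    let a , a-atom , _ , x≼ιa = FE.atom-below (λ a → x A.≼ ι a) ≢⊥ split x≼ι⊤ in a , a-atom , x≼ιa
    where
      ≢⊥ : ∀ {a} → x A.≼ ι a → a ≢ E.⊥'
      ≢⊥ x≼ιa refl = proj₁ x-atom (OA.x≼⊥⇒x≡⊥ (subst (x A.≼_) ι-⊥ x≼ιa))
      split : ∀ {a} e → x A.≼ ι a → x A.≼ ι (a E.∧ e) ⊎ x A.≼ ι (a E.∧ (E.- e))
      split {a} e x≼ιa with OA.atom-≼⊎≼¬ x-atom (ι e)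
      ... | inj₁ x≼ιe = inj₁ (subst (x A.≼_) (sym (ι-∧ a e)) (OA.∧-greatest x≼ιa x≼ιe))
      ... | inj₂ x≼¬ιe = inj₂ (subst (x A.≼_) (sym (trans (ι-∧ a (E.- e)) (cong (ι a A.∧_) (¬-hom e))))
                                (OA.∧-greatest x≼ιa x≼¬ιe))
      x≼ι⊤ : x A.≼ ι E.⊤'
      x≼ι⊤ = subst (x A.≼_) (sym ι-⊤) OA.x≼⊤

  private
    pick : ∀ {x} → Dec (∃ (IsC x)) → E.Carrier
    pick (yes (a , _)) = a
    pick (no _) = E.⊤'

    pick-IsC : ∀ {x} (d : Dec (∃ (IsC x))) → ∃ (IsC x) → IsC x (pick d)
    pick-IsC (yes (_ , isC)) _ = isC
    pick-IsC (no ∄) ∃a = ⊥-elim (∄ ∃a)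

  -- The map c(x), found by search; on non-atoms of 𝔄 it is the junk value ⊤'.
  c : A.Carrier → E.Carrier
  c x = pick (FE.∃? (IsC? x))

  c-IsC : ∀ {x} → A.IsAtom x → IsC x (c x)
  c-IsC {x} x-atom = pick-IsC (FE.∃? (IsC? x)) (atom-above x-atom)

  c-atom : ∀ {x} → A.IsAtom x → E.IsAtom (c x)
  c-atom = proj₁ ∘ c-IsC

  c-above : ∀ {x} → A.IsAtom x → x A.≼ ι (c x)
  c-above = proj₂ ∘ c-IsC

  c-unique : ∀ {x a} → A.IsAtom x → E.IsAtom a → x A.≼ ι a → c x ≡ a
  c-unique x-atom a-atom = overlap⇒atom≡ (c-atom x-atom) a-atom (proj₁ x-atom) (c-above x-atom)

  c-⨾ : ∀ {x y z} → A.IsAtom x → A.IsAtom y → A.IsAtom z → z A.≼ (x A.⨾ y) → c z E.≼ (c x E.⨾ c y)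
  c-⨾ x-atom y-atom z-atom z≼x⨾y = overlap⇒atom≼ (c-atom z-atom) (proj₁ z-atom) (c-above z-atom)
    (OA.≼-trans z≼x⨾y (subst (_ A.≼_) (sym (⨾-hom _ _)) (SA.⨾-mono (c-above x-atom) (c-above y-atom))))

  ≼ι-div⇒div : ∀ {a x} → E.DivAtom a → A.IsAtom x → x A.≼ ι a → A.DivAtom x
  ≼ι-div⇒div (_ , a≼0') x-atom x≼ιa = x-atom , OA.≼-trans x≼ιa (subst (ι _ A.≼_) ι-0' (ι-mono a≼0'))

  c-div : ∀ {x} → A.DivAtom x → E.DivAtom (c x)
  c-div {x} (x-atom , x≼0') with OE.atom-≼⊎≼¬ (c-atom x-atom) E.1'
  ... | inj₂ cx≼0' = c-atom x-atom , cx≼0'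
  ... | inj₁ cx≼1' = ⊥-elim (proj₁ x-atom (OA.x≼y⇒x≼¬y⇒x≡⊥
          (OA.≼-trans (c-above x-atom) (subst (ι (c x) A.≼_) 1'-hom (ι-mono cx≼1'))) x≼0'))

  div-atom-under : ∀ {a} → E.DivAtom a → ∃[ x ] (A.DivAtom x × x A.≼ ι a)
  div-atom-under a-div =
    let x , x-atom , x≼ιa = FA.nonzero⇒atom-below (ι-≢⊥ (proj₁ (proj₁ a-div))) in
    x , ≼ι-div⇒div a-div x-atom x≼ιa , x≼ιa

  1'⋠div : ∀ {a} → E.DivAtom a → ¬ (E.1' E.≼ a)
  1'⋠div (_ , a≼0') 1'≼a = proj₁ intE (OE.x≼y⇒x≼¬y⇒x≡⊥ OE.≼-refl (OE.≼-trans 1'≼a a≼0'))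

  SameC? : ∀ x y z → Dec (SameC x y z)
  SameC? x y z = FE.∃? (λ a → IsC? x a ×-dec (IsC? y a ×-dec IsC? z a))

  SameC⇒c≡ : ∀ {x y z} → A.IsAtom x → A.IsAtom y → A.IsAtom z → SameC x y z → c x ≡ c z × c y ≡ c z
  SameC⇒c≡ x-atom y-atom z-atom (a , (a-atom , x≼ιa) , (_ , y≼ιa) , (_ , z≼ιa)) =
    trans cx≡a (sym cz≡a) , trans (c-unique y-atom a-atom y≼ιa) (sym cz≡a)
    where
      cx≡a = c-unique x-atom a-atom x≼ιa
      cz≡a = c-unique z-atom a-atom z≼ιa

  c≡⇒SameC : ∀ {x y z a} → A.IsAtom x → A.IsAtom y → A.IsAtom z →
             c x ≡ a → c y ≡ a → c z ≡ a → SameC x y z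
  c≡⇒SameC x-atom y-atom z-atom cx≡a cy≡a cz≡a =
    _ , subst (IsC _) cx≡a (c-IsC x-atom) , subst (IsC _) cy≡a (c-IsC y-atom) , subst (IsC _) cz≡a (c-IsC z-atom)

  T-rotate : ∀ {i j k} → T i j k → T k i j
  T-rotate (inj₁ t) = inj₂ (inj₁ t)
  T-rotate (inj₂ (inj₁ t)) = inj₂ (inj₂ t)
  T-rotate (inj₂ (inj₂ t)) = inj₁ t

  T-swap₁₂ : ∀ {i j k} → T i j k → T j i k
  T-swap₁₂ (inj₁ (i≤j , refl)) = inj₂ (inj₁ (i≤j , refl))
  T-swap₁₂ (inj₂ (inj₁ (j≤k , refl))) = inj₁ (j≤k , refl)
  T-swap₁₂ (inj₂ (inj₂ (k≤i , refl))) = inj₂ (inj₂ (k≤i , refl))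

  T-swap₂₃ : ∀ {i j k} → T i j k → T i k j
  T-swap₂₃ = T-swap₁₂ ∘ T-rotate

  T? : ∀ i j k → Dec (T i j k)
  T? i j k = ((i ℕₚ.≤? j) ×-dec (j ℕₚ.≟ k))
       ⊎-dec (((j ℕₚ.≤? k) ×-dec (k ℕₚ.≟ i)) ⊎-dec ((k ℕₚ.≤? i) ×-dec (i ℕₚ.≟ j)))

  ¬T-strict-max : ∀ {i j k} → i < k → j < k → ¬ T i j k
  ¬T-strict-max i<k j<k (inj₁ (_ , refl)) = <-irrefl refl j<k
  ¬T-strict-max i<k j<k (inj₂ (inj₁ (_ , refl))) = <-irrefl refl i<k
  ¬T-strict-max i<k j<k (inj₂ (inj₂ (k≤i , _))) = ≤⇒≯ k≤i i<k

  Cy-swap : ∀ {u v w} → Cy u v w → Cy v u w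
  Cy-swap (inj₁ b) = inj₂ (inj₂ (inj₁ b))
  Cy-swap (inj₂ (inj₁ b)) = inj₂ (inj₂ (inj₂ (inj₁ b)))
  Cy-swap (inj₂ (inj₂ (inj₁ b))) = inj₁ b
  Cy-swap (inj₂ (inj₂ (inj₂ (inj₁ b)))) = inj₂ (inj₁ b)
  Cy-swap (inj₂ (inj₂ (inj₂ (inj₂ (inj₁ b))))) = inj₂ (inj₂ (inj₂ (inj₂ (inj₂ b))))
  Cy-swap (inj₂ (inj₂ (inj₂ (inj₂ (inj₂ b))))) = inj₂ (inj₂ (inj₂ (inj₂ (inj₁ b))))

  Base-valid : ∀ {u v w} → Base u v w → ValidAt u × ValidAt v × ValidAt w
  Base-valid ididid = tt , tt , tt
  Base-valid (idxx _ _ x-div) = tt , x-div , x-div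
  Base-valid (xyz _ _ _ _ _ _ x-div y-div z-div _ _) = x-div , y-div , z-div

  Cy-valid₃ : ∀ {u v w} → Cy u v w → ValidAt w
  Cy-valid₃ (inj₁ b) = proj₂ (proj₂ (Base-valid b))
  Cy-valid₃ (inj₂ (inj₁ b)) = proj₁ (proj₂ (Base-valid b))
  Cy-valid₃ (inj₂ (inj₂ (inj₁ b))) = proj₂ (proj₂ (Base-valid b))
  Cy-valid₃ (inj₂ (inj₂ (inj₂ (inj₁ b)))) = proj₁ (proj₂ (Base-valid b))
  Cy-valid₃ (inj₂ (inj₂ (inj₂ (inj₂ (inj₁ b))))) = proj₁ (Base-valid b)
  Cy-valid₃ (inj₂ (inj₂ (inj₂ (inj₂ (inj₂ b))))) = proj₁ (Base-valid b)

  Cy-1'ˡ : ∀ {w} → ValidAt w → Cy nothing w w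
  Cy-1'ˡ {nothing} _ = inj₁ ididid
  Cy-1'ˡ {just (x , i)} x-div = inj₁ (idxx x i x-div)

  Cy-1'₃ : ∀ {x i} → A.DivAtom x → Cy (just (x , i)) (just (x , i)) nothing
  Cy-1'₃ x-div = inj₂ (inj₂ (inj₂ (inj₂ (inj₁ (idxx _ _ x-div)))))

  Cy-1'ˡ⁻ : ∀ {v w} → Cy nothing v w → v ≡ w
  Cy-1'ˡ⁻ (inj₁ ididid) = refl
  Cy-1'ˡ⁻ (inj₁ (idxx _ _ _)) = refl
  Cy-1'ˡ⁻ (inj₂ (inj₁ ididid)) = refl
  Cy-1'ˡ⁻ (inj₂ (inj₁ (idxx _ _ _))) = refl
  Cy-1'ˡ⁻ (inj₂ (inj₂ (inj₁ ididid))) = refl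
  Cy-1'ˡ⁻ (inj₂ (inj₂ (inj₂ (inj₁ ididid)))) = refl
  Cy-1'ˡ⁻ (inj₂ (inj₂ (inj₂ (inj₂ (inj₁ ididid))))) = refl
  Cy-1'ˡ⁻ (inj₂ (inj₂ (inj₂ (inj₂ (inj₂ ididid))))) = refl

  Cy-1'ʳ⁻ : ∀ {u w} → Cy u nothing w → u ≡ w
  Cy-1'ʳ⁻ = Cy-1'ˡ⁻ ∘ Cy-swap

  Cy-1'₃⁻ : ∀ {p q} → Cy (just p) (just q) nothing → p ≡ q
  Cy-1'₃⁻ (inj₂ (inj₂ (inj₂ (inj₂ (inj₁ (idxx _ _ _)))))) = refl
  Cy-1'₃⁻ (inj₂ (inj₂ (inj₂ (inj₂ (inj₂ (idxx _ _ _)))))) = refl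

  Cy-copies : ∀ {x i y j z k} → A.DivAtom x → A.DivAtom y → A.DivAtom z →
              z A.≼ (x A.⨾ y) → (SameC x y z → T i j k) → Cy (just (x , i)) (just (y , j)) (just (z , k))
  Cy-copies x-div y-div z-div z≼x⨾y t = inj₁ (xyz _ _ _ _ _ _ x-div y-div z-div z≼x⨾y t)

  -- In a symmetric algebra the cycle law makes z ≤ x;y invariant under permuting x, y, z.
  Cy-copies⁻ : ∀ {x i y j z k} → Cy (just (x , i)) (just (y , j)) (just (z , k)) →
               A.DivAtom x × A.DivAtom y × A.DivAtom z × z A.≼ (x A.⨾ y) × (SameC x y z → T i j k)
  Cy-copies⁻ (inj₁ (xyz _ _ _ _ _ _ x-div y-div z-div z≼x⨾y t)) = x-div , y-div , z-div , z≼x⨾y , t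
  Cy-copies⁻ (inj₂ (inj₁ (xyz _ _ _ _ _ _ x-div z-div y-div y≼x⨾z t))) =
    x-div , y-div , z-div , SA.≼⨾-cycle (proj₁ y-div) (proj₁ z-div) y≼x⨾z ,
    λ (a , p , q , r) → T-swap₂₃ (t (a , p , r , q))
  Cy-copies⁻ (inj₂ (inj₂ (inj₁ (xyz _ _ _ _ _ _ y-div x-div z-div z≼y⨾x t)))) =
    x-div , y-div , z-div , subst (_ A.≼_) (SA.⨾-comm _ _) z≼y⨾x ,
    λ (a , p , q , r) → T-swap₁₂ (t (a , q , p , r))
  Cy-copies⁻ (inj₂ (inj₂ (inj₂ (inj₁ (xyz _ _ _ _ _ _ y-div z-div x-div x≼y⨾z t))))) =
    x-div , y-div , z-div , subst (_ A.≼_) (SA.⨾-comm _ _) (SA.≼⨾-cycle (proj₁ x-div) (proj₁ z-div) x≼y⨾z) ,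
    λ (a , p , q , r) → T-rotate (t (a , q , r , p))
  Cy-copies⁻ (inj₂ (inj₂ (inj₂ (inj₂ (inj₁ (xyz _ _ _ _ _ _ z-div x-div y-div y≼z⨾x t)))))) =
    x-div , y-div , z-div , SA.≼⨾-cycle (proj₁ y-div) (proj₁ z-div) (subst (_ A.≼_) (SA.⨾-comm _ _) y≼z⨾x) ,
    λ (a , p , q , r) → T-rotate (T-rotate (t (a , r , p , q)))
  Cy-copies⁻ (inj₂ (inj₂ (inj₂ (inj₂ (inj₂ (xyz _ _ _ _ _ _ z-div y-div x-div x≼z⨾y t)))))) =
    x-div , y-div , z-div ,
    subst (_ A.≼_) (SA.⨾-comm _ _)
          (SA.≼⨾-cycle (proj₁ x-div) (proj₁ z-div) (subst (_ A.≼_) (SA.⨾-comm _ _) x≼z⨾y)) ,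
    λ (a , p , q , r) → T-rotate (T-swap₁₂ (t (a , r , q , p)))

  ⨾C-comm : ∀ {X Y w} → (X ⨾C Y) w → (Y ⨾C X) w
  ⨾C-comm (u , v , Xu , Yv , cy) = v , u , Yv , Xu , Cy-swap cy

  module Blocks (n : ℕ) where

    _≟ᴮ_ : DecidableEquality BIdx
    _≟ᴮ_ = ⊎.≡-dec ⊤._≟_ (⊎.≡-dec (Σ.≡-dec FA._≟_ ℕₚ._≟_) FE._≟_)

    ValidIdx? : ∀ k → Dec (ValidIdx n k)
    ValidIdx? idᴮ = yes tt
    ValidIdx? (atᴮ x i) = (FA.IsAtom? x ×-dec (x FA.≼? A.0')) ×-dec (i <? n)
    ValidIdx? (Jᴮ a) = FE.IsAtom? a ×-dec (a FE.≼? E.0')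

    -- A valid copy index is below n, so searching over copies is a search over Fin n.
    any-valid? : {P : BIdx → Set} → (∀ k → Dec (P k)) → Dec (∃[ k ] (ValidIdx n k × P k))
    any-valid? {P} P? = map′ to from
      (D? idᴮ ⊎-dec (FA.∃? (λ x → any? (λ (i : Fin n) → D? (atᴮ x (toℕ i)))) ⊎-dec FE.∃? (D? ∘ Jᴮ)))
      where
        D : BIdx → Set
        D k = ValidIdx n k × P k
        D? : ∀ k → Dec (D k)
        D? k = ValidIdx? k ×-dec P? k
        Cases : Set
        Cases = D idᴮ ⊎ (∃[ x ] ∃[ i ] D (atᴮ x (toℕ {n} i))) ⊎ ∃[ a ] D (Jᴮ a)
        to : Cases → ∃ D
        to (inj₁ d) = idᴮ , d
        to (inj₂ (inj₁ (x , i , d))) = atᴮ x (toℕ i) , d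
        to (inj₂ (inj₂ (a , d))) = Jᴮ a , d
        from : ∃ D → Cases
        from (idᴮ , d) = inj₁ d
        from (atᴮ x i , d@((_ , i<n) , _)) =
          inj₂ (inj₁ (x , fromℕ< i<n , subst (D ∘ atᴮ x) (sym (toℕ-fromℕ< i<n)) d))
        from (Jᴮ a , d) = inj₂ (inj₂ (a , d))

    1'∉J : ∀ {a} → E.DivAtom a → ¬ J a n nothing
    1'∉J _ (inj₁ (_ , _ , () , _))
    1'∉J a-div (inj₂ (_ , 1'≼a)) = 1'⋠div a-div 1'≼a

    J-copy⁻ : ∀ {a x i} → J a n (just (x , i)) → A.DivAtom x × x A.≼ ι a × n ≤ i
    J-copy⁻ (inj₁ (_ , _ , refl , x-div , x≼ιa , n≤i)) = x-div , x≼ιa , n≤i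

    J-copy⁺ : ∀ {a x i} → A.DivAtom x → x A.≼ ι a → n ≤ i → J a n (just (x , i))
    J-copy⁺ x-div x≼ιa n≤i = inj₁ (_ , _ , refl , x-div , x≼ιa , n≤i)

    block-valid : ∀ {k w} → ValidIdx n k → elt n k w → ValidAt w
    block-valid {idᴮ} _ refl = tt
    block-valid {atᴮ _ _} (x-div , _) refl = x-div
    block-valid {Jᴮ _} _ (inj₁ (_ , _ , refl , x-div , _)) = x-div
    block-valid {Jᴮ _} _ (inj₂ (refl , _)) = tt

    block-disjoint : ∀ {k k′ w} → ValidIdx n k → ValidIdx n k′ → elt n k w → elt n k′ w → k ≡ k′
    block-disjoint {idᴮ} {idᴮ} _ _ _ _ = refl
    block-disjoint {idᴮ} {atᴮ _ _} _ _ refl ()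
    block-disjoint {idᴮ} {Jᴮ _} _ a-div refl 1'∈J = ⊥-elim (1'∉J a-div 1'∈J)
    block-disjoint {atᴮ _ _} {idᴮ} _ _ refl ()
    block-disjoint {atᴮ _ _} {atᴮ _ _} _ _ refl refl = refl
    block-disjoint {atᴮ _ _} {Jᴮ _} (_ , i<n) _ refl copy∈J =
      ⊥-elim (≤⇒≯ (proj₂ (proj₂ (J-copy⁻ copy∈J))) i<n)
    block-disjoint {Jᴮ _} {idᴮ} a-div _ 1'∈J refl = ⊥-elim (1'∉J a-div 1'∈J)
    block-disjoint {Jᴮ _} {atᴮ _ _} _ (_ , i<n) copy∈J refl =
      ⊥-elim (≤⇒≯ (proj₂ (proj₂ (J-copy⁻ copy∈J))) i<n)
    block-disjoint {Jᴮ _} {Jᴮ _} {nothing} a-div _ 1'∈J _ = ⊥-elim (1'∉J a-div 1'∈J)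
    block-disjoint {Jᴮ _} {Jᴮ _} {just _} a-div b-div x∈Ja x∈Jb =
      let x-div , x≼ιa , _ = J-copy⁻ x∈Ja in
      cong Jᴮ (overlap⇒atom≡ (proj₁ a-div) (proj₁ b-div) (proj₁ (proj₁ x-div))
                             x≼ιa (proj₁ (proj₂ (J-copy⁻ x∈Jb))))

    block-cover : ∀ {w} → ValidAt w → ∃[ k ] (ValidIdx n k × elt n k w)
    block-cover {nothing} _ = idᴮ , tt , refl
    block-cover {just (x , i)} x-div with i <? n
    ... | yes i<n = atᴮ x i , (x-div , i<n) , refl
    ... | no i≮n = Jᴮ (c x) , c-div x-div , J-copy⁺ x-div (c-above (proj₁ x-div)) (≮⇒≥ i≮n)

    block-nonempty : ∀ {k} → ValidIdx n k → ∃[ w ] elt n k w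
    block-nonempty {idᴮ} _ = nothing , refl
    block-nonempty {atᴮ x i} _ = just (x , i) , refl
    block-nonempty {Jᴮ a} a-div =
      let x , x-div , x≼ιa = div-atom-under a-div in just (x , n) , J-copy⁺ x-div x≼ιa ≤-refl

    does-true⇒ : ∀ {P : Set} (P? : Dec P) → does P? ≡ true → P
    does-true⇒ (yes p) _ = p

    Joins-of : (P : BIdx → Set) → (∀ k → Dec (P k)) → (∀ {k} → P k → ValidIdx n k) →
               ∀ {Z} → Z ≈ (λ w → ∃[ k ] (P k × elt n k w)) → Joins n Z
    Joins-of P P? valid (Z⊆ , ⊆Z) =
      (does ∘ P?) ,
      (λ k s → valid (does-true⇒ (P? k) s)) ,
      (λ w Zw → let k , Pk , w∈k = Z⊆ w Zw in k , dec-true (P? k) Pk , w∈k) ,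
      (λ w (k , s , w∈k) → ⊆Z w (k , does-true⇒ (P? k) s , w∈k))

    Joins-resp-≈ : ∀ {X Y} → X ≈ Y → Joins n X → Joins n Y
    Joins-resp-≈ (X⊆Y , Y⊆X) (S , valid , X⊆ , ⊆X) =
      S , valid , (λ w → X⊆ w ∘ Y⊆X w) , (λ w → X⊆Y w ∘ ⊆X w)

    block∈Joins : ∀ {k} → ValidIdx n k → Joins n (elt n k)
    block∈Joins {k} valid-k = Joins-of (_≡ k) (_≟ᴮ k) (λ { refl → valid-k })
      ((λ w w∈k → k , refl , w∈k) , (λ { w (_ , refl , w∈k) → w∈k }))

    ∪-closed : ∀ {X Y} → Joins n X → Joins n Y → Joins n (X ∪ Y)
    ∪-closed (S₁ , valid₁ , X⊆ , ⊆X) (S₂ , valid₂ , Y⊆ , ⊆Y) =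
      Joins-of (λ k → S₁ k ≡ true ⊎ S₂ k ≡ true) (λ k → (S₁ k ≟𝔹 true) ⊎-dec (S₂ k ≟𝔹 true))
        (λ { (inj₁ s) → valid₁ _ s ; (inj₂ s) → valid₂ _ s })
        ((λ { w (inj₁ Xw) → let k , s , w∈k = X⊆ w Xw in k , inj₁ s , w∈k
            ; w (inj₂ Yw) → let k , s , w∈k = Y⊆ w Yw in k , inj₂ s , w∈k }) ,
         (λ { w (k , inj₁ s , w∈k) → inj₁ (⊆X w (k , s , w∈k))
            ; w (k , inj₂ s , w∈k) → inj₂ (⊆Y w (k , s , w∈k)) }))

    -- The blocks partition the valid atoms, so the complement of a join is the join of the other blocks.
    ∼-closed : ∀ {X} → Joins n X → Joins n (∼ X)
    ∼-closed (S , valid , X⊆ , ⊆X) =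
      Joins-of (λ k → ValidIdx n k × ¬ (S k ≡ true)) (λ k → ValidIdx? k ×-dec ¬? (S k ≟𝔹 true)) proj₁
        ((λ w (w-valid , ¬Xw) → let k , valid-k , w∈k = block-cover w-valid in
                                k , (valid-k , λ s → ¬Xw (⊆X w (k , s , w∈k))) , w∈k) ,
         (λ w (k , (valid-k , ¬s) , w∈k) → block-valid valid-k w∈k ,
           λ Xw → let k′ , s′ , w∈k′ = X⊆ w Xw in
                  ¬s (subst (λ k → S k ≡ true) (block-disjoint (valid k′ s′) valid-k w∈k′ w∈k) s′)))

    AtomOf⇒InB : ∀ Z → AtomOf (Joins n) Z → InB n Z
    AtomOf⇒InB Z ((S , valid , Z⊆ , ⊆Z) , Z≉∅ , minimal) with any-valid? (λ k → S k ≟𝔹 true)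
    ... | no none = ⊥-elim (Z≉∅ ((λ w Zw → let k , s , _ = Z⊆ w Zw in none (k , valid k s , s)) , λ _ ()))
    ... | yes (k , valid-k , s) with minimal (elt n k) (block∈Joins valid-k) (λ w w∈k → ⊆Z w (k , s , w∈k))
    ...   | inj₁ (k⊆∅ , _) = ⊥-elim (let w , w∈k = block-nonempty valid-k in k⊆∅ w w∈k)
    ...   | inj₂ (k⊆Z , Z⊆k) = k , valid-k , Z⊆k , k⊆Z

    InB⇒AtomOf : ∀ Z → InB n Z → AtomOf (Joins n) Z
    InB⇒AtomOf Z (k , valid-k , Z⊆k , k⊆Z) =
      Joins-resp-≈ (k⊆Z , Z⊆k) (block∈Joins valid-k) ,
      (λ (Z⊆∅ , _) → let w , w∈k = block-nonempty valid-k in Z⊆∅ w (k⊆Z w w∈k)) ,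
      minimal
      where
        minimal : ∀ W → Joins n W → W ⊆ Z → (W ≈ ∅) ⊎ (W ≈ Z)
        minimal W (S , valid , W⊆ , ⊆W) W⊆Z with S k ≟𝔹 true
        ... | yes s = inj₂ (W⊆Z , λ w Zw → ⊆W w (k , s , Z⊆k w Zw))
        ... | no ¬s = inj₁ ((λ w Ww → let k′ , s′ , w∈k′ = W⊆ w Ww in
                               ¬s (subst (λ k → S k ≡ true)
                                         (block-disjoint (valid k′ s′) valid-k w∈k′ (Z⊆k w (W⊆Z w Ww))) s′)) ,
                            λ _ ())

    module _ (special : IsSpecial) where
      open IsSpecial special

      MixedCycle : E.Carrier → E.Carrier → E.Carrier → Set
      MixedCycle a b e = e E.≼ (a E.⨾ b) × ¬ (a ≡ e × b ≡ e)

      MixedCycle? : ∀ a b e → Dec (MixedCycle a b e)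
      MixedCycle? a b e = (e FE.≼? (a E.⨾ b)) ×-dec ¬? ((a FE.≟ e) ×-dec (b FE.≟ e))

      mixed⇒ι≼⨾ : ∀ {x y e} → A.DivAtom x → A.DivAtom y → E.DivAtom e →
                  MixedCycle (c x) (c y) e → ι e A.≼ (x A.⨾ y)
      mixed⇒ι≼⨾ x-div y-div e-div (e≼ , not-flat) =
        cond1 _ _ _ (c-div x-div) (c-div y-div) e-div (λ (p , q) → not-flat (trans p q , q)) e≼
              _ _ (proj₁ x-div) (proj₁ y-div) (c-above (proj₁ x-div)) (c-above (proj₁ y-div))

      -- Conditions (1) and (2) together: every cycle b ≤ c(x);c(z) of 𝔈 is realised by an atom y ≤ b.
      third-side : ∀ {x z b} → A.DivAtom x → A.DivAtom z → E.DivAtom b → b E.≼ (c x E.⨾ c z) →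
                   ∃[ y ] (A.DivAtom y × y A.≼ ι b × z A.≼ (x A.⨾ y))
      third-side {x} {z} {b} x-div z-div b-div b≼ with (c x FE.≟ b) ×-dec (c z FE.≟ b)
      ... | no not-flat =
        let y , y-div , y≼ιb = div-atom-under b-div in
        y , y-div , y≼ιb ,
        SA.≼⨾-cycle (proj₁ y-div) (proj₁ z-div)
                    (OA.≼-trans y≼ιb (mixed⇒ι≼⨾ x-div z-div b-div (b≼ , not-flat)))
      ... | yes (cx≡b , cz≡b) =
        let x≼ιb = subst (λ a → x A.≼ ι a) cx≡b (c-above (proj₁ x-div))
            z≼ιb = subst (λ a → z A.≼ ι a) cz≡b (c-above (proj₁ z-div))
            b≼b⨾b = subst₂ (λ a a′ → b E.≼ (a E.⨾ a′)) cx≡b cz≡b b≼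
            y , y-atom , y≼ = FA.nonzero⇒atom-below
                                (cond2 b b-div b≼b⨾b x z (proj₁ x-div) (proj₁ z-div) x≼ιb z≼ιb)
            y≼ιb = OA.≼-trans y≼ OA.x∧y≼y
        in y , ≼ι-div⇒div b-div y-atom y≼ιb , y≼ιb ,
           SA.≼⨾-cycle y-atom (proj₁ z-div) (OA.≼-trans y≼ OA.x∧y≼x)

      InCopy⨾J : A.Carrier → E.Carrier → BIdx → Set
      InCopy⨾J x b idᴮ = ⊥
      InCopy⨾J x b (atᴮ z k) = MixedCycle (c x) (c z) b
      InCopy⨾J x b (Jᴮ e) = b E.≼ (c x E.⨾ e)

      InCopy⨾J? : ∀ x b k → Dec (InCopy⨾J x b k)
      InCopy⨾J? x b idᴮ = no λ ()
      InCopy⨾J? x b (atᴮ z k) = MixedCycle? (c x) (c z) b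
      InCopy⨾J? x b (Jᴮ e) = b FE.≼? (c x E.⨾ e)

      -- InProduct k₁ k₂ k: the block k lies inside the composite of the blocks k₁ and k₂.
      InProduct : BIdx → BIdx → BIdx → Set
      InProduct idᴮ k₂ k = k ≡ k₂
      InProduct (atᴮ x i) idᴮ k = k ≡ atᴮ x i
      InProduct (Jᴮ a) idᴮ k = k ≡ Jᴮ a
      InProduct (atᴮ x i) (atᴮ y j) idᴮ = (x , i) ≡ (y , j)
      InProduct (atᴮ x i) (atᴮ y j) (atᴮ z k) = z A.≼ (x A.⨾ y) × (SameC x y z → T i j k)
      InProduct (atᴮ x i) (atᴮ y j) (Jᴮ e) = MixedCycle (c x) (c y) e
      InProduct (atᴮ x i) (Jᴮ b) k = InCopy⨾J x b k
      InProduct (Jᴮ a) (atᴮ y j) k = InCopy⨾J y a k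
      InProduct (Jᴮ a) (Jᴮ b) idᴮ = a ≡ b
      InProduct (Jᴮ a) (Jᴮ b) (atᴮ z k) = c z E.≼ (a E.⨾ b)
      InProduct (Jᴮ a) (Jᴮ b) (Jᴮ e) = e E.≼ (a E.⨾ b)

      InProduct? : ∀ k₁ k₂ k → Dec (InProduct k₁ k₂ k)
      InProduct? idᴮ k₂ k = k ≟ᴮ k₂
      InProduct? (atᴮ x i) idᴮ k = k ≟ᴮ atᴮ x i
      InProduct? (Jᴮ a) idᴮ k = k ≟ᴮ Jᴮ a
      InProduct? (atᴮ x i) (atᴮ y j) idᴮ = Σ.≡-dec FA._≟_ ℕₚ._≟_ (x , i) (y , j)
      InProduct? (atᴮ x i) (atᴮ y j) (atᴮ z k) = (z FA.≼? (x A.⨾ y)) ×-dec (SameC? x y z →-dec T? i j k)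
      InProduct? (atᴮ x i) (atᴮ y j) (Jᴮ e) = MixedCycle? (c x) (c y) e
      InProduct? (atᴮ x i) (Jᴮ b) k = InCopy⨾J? x b k
      InProduct? (Jᴮ a) (atᴮ y j) k = InCopy⨾J? y a k
      InProduct? (Jᴮ a) (Jᴮ b) idᴮ = a FE.≟ b
      InProduct? (Jᴮ a) (Jᴮ b) (atᴮ z k) = c z FE.≼? (a E.⨾ b)
      InProduct? (Jᴮ a) (Jᴮ b) (Jᴮ e) = e FE.≼? (a E.⨾ b)

      copy⨾J-⊇ : ∀ {x i b k} → ValidIdx n (atᴮ x i) → E.DivAtom b → ValidIdx n k →
                 InCopy⨾J x b k → elt n k ⊆ (sing x i ⨾C J b n)
      copy⨾J-⊇ {k = atᴮ z k} (x-div , _) b-div (z-div , _) mixed _ refl =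
        let y , y-div , y≼ιb , z≼x⨾y = third-side x-div z-div b-div (proj₁ mixed)
            cy≡b = c-unique (proj₁ y-div) (proj₁ b-div) y≼ιb
        in just _ , just (y , n) , refl , J-copy⁺ y-div y≼ιb ≤-refl ,
           Cy-copies x-div y-div z-div z≼x⨾y λ same →
             let cx≡cz , cy≡cz = SameC⇒c≡ (proj₁ x-div) (proj₁ y-div) (proj₁ z-div) same
                 cz≡b = trans (sym cy≡cz) cy≡b
             in ⊥-elim (proj₂ mixed (trans cx≡cz cz≡b , cz≡b))
      copy⨾J-⊇ {k = Jᴮ e} _ _ e-div _ nothing 1'∈J = ⊥-elim (1'∉J e-div 1'∈J)
      copy⨾J-⊇ {x} {b = b} {k = Jᴮ e} (x-div , i<n) b-div e-div b≼ (just (z , k)) z∈J =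
        let z-div , z≼ιe , n≤k = J-copy⁻ z∈J
            cz≡e = c-unique (proj₁ z-div) (proj₁ e-div) z≼ιe
            y , y-div , y≼ιb , z≼x⨾y =
              third-side x-div z-div b-div (subst (λ a → b E.≼ (c x E.⨾ a)) (sym cz≡e) b≼)
        in just _ , just (y , k) , refl , J-copy⁺ y-div y≼ιb n≤k ,
           Cy-copies x-div y-div z-div z≼x⨾y (λ _ → inj₁ (≤-trans (<⇒≤ i<n) n≤k , refl))

      -- Indices n ⊔ k on both sides make T hold whatever the index k of z is.
      J⨾J-⊇ : ∀ {a b z} → E.DivAtom a → E.DivAtom b → A.DivAtom z → c z E.≼ (a E.⨾ b) →
              ∀ k → (J a n ⨾C J b n) (just (z , k))
      J⨾J-⊇ {a} {b} {z} a-div b-div z-div cz≼a⨾b k =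
        let x , x-div , x≼ιa = div-atom-under a-div
            cx≡a = c-unique (proj₁ x-div) (proj₁ a-div) x≼ιa
            b≼a⨾cz = SE.≼⨾-cycle (c-atom (proj₁ z-div)) (proj₁ b-div) cz≼a⨾b
            y , y-div , y≼ιb , z≼x⨾y =
              third-side x-div z-div b-div (subst (λ a → b E.≼ (a E.⨾ c z)) (sym cx≡a) b≼a⨾cz)
        in just (x , n ⊔ k) , just (y , n ⊔ k) ,
           J-copy⁺ x-div x≼ιa (m≤m⊔n n k) , J-copy⁺ y-div y≼ιb (m≤m⊔n n k) ,
           Cy-copies x-div y-div z-div z≼x⨾y (λ _ → inj₂ (inj₂ (m≤n⊔m n k , refl)))

      1'⨾-⊇ : ∀ {k} → ValidIdx n k → elt n k ⊆ (idC ⨾C elt n k)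
      1'⨾-⊇ valid-k w w∈k = nothing , w , refl , w∈k , Cy-1'ˡ (block-valid valid-k w∈k)

      ⨾1'-⊇ : ∀ {k} → ValidIdx n k → elt n k ⊆ (elt n k ⨾C idC)
      ⨾1'-⊇ valid-k w = ⨾C-comm ∘ 1'⨾-⊇ valid-k w

      InProduct⇒⊆ : ∀ {k₁ k₂ k} → ValidIdx n k₁ → ValidIdx n k₂ → ValidIdx n k →
                    InProduct k₁ k₂ k → elt n k ⊆ (elt n k₁ ⨾C elt n k₂)
      InProduct⇒⊆ {idᴮ} {k₂} _ valid₂ _ refl = 1'⨾-⊇ {k₂} valid₂
      InProduct⇒⊆ {k₁@(atᴮ _ _)} {idᴮ} valid₁ _ _ refl = ⨾1'-⊇ {k₁} valid₁
      InProduct⇒⊆ {k₁@(Jᴮ _)} {idᴮ} valid₁ _ _ refl = ⨾1'-⊇ {k₁} valid₁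
      InProduct⇒⊆ {atᴮ _ _} {atᴮ _ _} {idᴮ} (x-div , _) _ _ refl _ refl =
        just _ , just _ , refl , refl , Cy-1'₃ x-div
      InProduct⇒⊆ {atᴮ _ _} {atᴮ _ _} {atᴮ _ _} (x-div , _) (y-div , _) (z-div , _) (z≼x⨾y , t) _ refl =
        just _ , just _ , refl , refl , Cy-copies x-div y-div z-div z≼x⨾y t
      InProduct⇒⊆ {atᴮ _ _} {atᴮ _ _} {Jᴮ _} _ _ e-div _ nothing 1'∈J = ⊥-elim (1'∉J e-div 1'∈J)
      InProduct⇒⊆ {atᴮ _ _} {atᴮ _ _} {Jᴮ _} (x-div , _) (y-div , _) e-div mixed (just _) z∈J =
        let z-div , z≼ιe , _ = J-copy⁻ z∈J
            cz≡e = c-unique (proj₁ z-div) (proj₁ e-div) z≼ιe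
        in just _ , just _ , refl , refl ,
           Cy-copies x-div y-div z-div (OA.≼-trans z≼ιe (mixed⇒ι≼⨾ x-div y-div e-div mixed)) λ same →
             let cx≡cz , cy≡cz = SameC⇒c≡ (proj₁ x-div) (proj₁ y-div) (proj₁ z-div) same
             in ⊥-elim (proj₂ mixed (trans cx≡cz cz≡e , trans cy≡cz cz≡e))
      InProduct⇒⊆ {atᴮ _ _} {Jᴮ _} valid₁ b-div valid in-product = copy⨾J-⊇ valid₁ b-div valid in-product
      InProduct⇒⊆ {Jᴮ _} {atᴮ _ _} a-div valid₂ valid in-product w =
        ⨾C-comm ∘ copy⨾J-⊇ valid₂ a-div valid in-product w
      InProduct⇒⊆ {Jᴮ _} {Jᴮ _} {idᴮ} a-div _ _ refl _ refl =
        let x , x-div , x≼ιa = div-atom-under a-div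
        in just (x , n) , just (x , n) , J-copy⁺ x-div x≼ιa ≤-refl , J-copy⁺ x-div x≼ιa ≤-refl , Cy-1'₃ x-div
      InProduct⇒⊆ {Jᴮ _} {Jᴮ _} {atᴮ _ k} a-div b-div (z-div , _) cz≼a⨾b _ refl =
        J⨾J-⊇ a-div b-div z-div cz≼a⨾b k
      InProduct⇒⊆ {Jᴮ _} {Jᴮ _} {Jᴮ _} _ _ e-div _ nothing 1'∈J = ⊥-elim (1'∉J e-div 1'∈J)
      InProduct⇒⊆ {Jᴮ a} {Jᴮ b} {Jᴮ _} a-div b-div e-div e≼a⨾b (just (_ , k)) z∈J =
        let z-div , z≼ιe , _ = J-copy⁻ z∈J
            cz≡e = c-unique (proj₁ z-div) (proj₁ e-div) z≼ιe
        in J⨾J-⊇ a-div b-div z-div (subst (E._≼ (a E.⨾ b)) (sym cz≡e) e≼a⨾b) k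

      copy⨾J-meets : ∀ {x i b k w} → ValidIdx n (atᴮ x i) → E.DivAtom b → ValidIdx n k → elt n k w →
                     (sing x i ⨾C J b n) w → InCopy⨾J x b k
      copy⨾J-meets _ b-div _ _ (_ , nothing , _ , 1'∈J , _) = ⊥-elim (1'∉J b-div 1'∈J)
      copy⨾J-meets {k = idᴮ} (_ , i<n) _ _ refl (_ , just _ , refl , y∈J , cy) with Cy-1'₃⁻ cy
      ... | refl = ⊥-elim (≤⇒≯ (proj₂ (proj₂ (J-copy⁻ y∈J))) i<n)
      copy⨾J-meets {k = atᴮ _ _} (_ , i<n) b-div (_ , k<n) refl (_ , just _ , refl , y∈J , cy) =
        let x-div , y-div , z-div , z≼x⨾y , t = Cy-copies⁻ cy
            _ , y≼ιb , n≤j = J-copy⁻ y∈J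
            cy≡b = c-unique (proj₁ y-div) (proj₁ b-div) y≼ιb
        in subst (E._≼ _) cy≡b (c-⨾ (proj₁ x-div) (proj₁ z-div) (proj₁ y-div)
                                    (SA.≼⨾-cycle (proj₁ z-div) (proj₁ y-div) z≼x⨾y)) ,
           λ (cx≡b , cz≡b) → ¬T-strict-max (<-≤-trans i<n n≤j) (<-≤-trans k<n n≤j)
             (T-swap₂₃ (t (c≡⇒SameC (proj₁ x-div) (proj₁ y-div) (proj₁ z-div) cx≡b cy≡b cz≡b)))
      copy⨾J-meets {k = Jᴮ _} {w = nothing} _ _ e-div 1'∈J _ = ⊥-elim (1'∉J e-div 1'∈J)
      copy⨾J-meets {k = Jᴮ _} {w = just _} _ b-div e-div z∈J (_ , just _ , refl , y∈J , cy) =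
        let x-div , y-div , z-div , z≼x⨾y , _ = Cy-copies⁻ cy
            _ , y≼ιb , _ = J-copy⁻ y∈J
            _ , z≼ιe , _ = J-copy⁻ z∈J
        in subst₂ (λ a a′ → a E.≼ (c _ E.⨾ a′))
                  (c-unique (proj₁ y-div) (proj₁ b-div) y≼ιb) (c-unique (proj₁ z-div) (proj₁ e-div) z≼ιe)
                  (c-⨾ (proj₁ x-div) (proj₁ z-div) (proj₁ y-div)
                       (SA.≼⨾-cycle (proj₁ z-div) (proj₁ y-div) z≼x⨾y))

      J⨾J⁻ : ∀ {a b w} → E.DivAtom a → E.DivAtom b → (J a n ⨾C J b n) w →
             ∃[ x ] ∃[ i ] ∃[ y ] ∃[ j ]
               (J a n (just (x , i)) × J b n (just (y , j)) × Cy (just (x , i)) (just (y , j)) w)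
      J⨾J⁻ a-div _ (nothing , _ , 1'∈J , _) = ⊥-elim (1'∉J a-div 1'∈J)
      J⨾J⁻ _ b-div (just _ , nothing , _ , 1'∈J , _) = ⊥-elim (1'∉J b-div 1'∈J)
      J⨾J⁻ _ _ (just _ , just _ , x∈J , y∈J , cy) = _ , _ , _ , _ , x∈J , y∈J , cy

      J⨾J-meets-copy : ∀ {a b z k} → E.DivAtom a → E.DivAtom b → (J a n ⨾C J b n) (just (z , k)) →
                       c z E.≼ (a E.⨾ b)
      J⨾J-meets-copy a-div b-div prod =
        let _ , _ , _ , _ , x∈J , y∈J , cy = J⨾J⁻ a-div b-div prod
            x-div , y-div , z-div , z≼x⨾y , _ = Cy-copies⁻ cy
        in subst₂ (λ a′ b′ → c _ E.≼ (a′ E.⨾ b′))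
                  (c-unique (proj₁ x-div) (proj₁ a-div) (proj₁ (proj₂ (J-copy⁻ x∈J))))
                  (c-unique (proj₁ y-div) (proj₁ b-div) (proj₁ (proj₂ (J-copy⁻ y∈J))))
                  (c-⨾ (proj₁ x-div) (proj₁ y-div) (proj₁ z-div) z≼x⨾y)

      ⨾1'-meets : ∀ {k₁ k w} → ValidIdx n k₁ → ValidIdx n k → elt n k w →
                  (elt n k₁ ⨾C idC) w → k ≡ k₁
      ⨾1'-meets {k₁} valid₁ valid w∈k (_ , _ , u∈k₁ , refl , cy) =
        block-disjoint valid valid₁ w∈k (subst (elt n k₁) (Cy-1'ʳ⁻ cy) u∈k₁)

      meets⇒InProduct : ∀ {k₁ k₂ k w} → ValidIdx n k₁ → ValidIdx n k₂ → ValidIdx n k →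
                        elt n k w → (elt n k₁ ⨾C elt n k₂) w → InProduct k₁ k₂ k
      meets⇒InProduct {idᴮ} {k₂} _ valid₂ valid w∈k (_ , _ , refl , v∈k₂ , cy) =
        block-disjoint valid valid₂ w∈k (subst (elt n k₂) (Cy-1'ˡ⁻ cy) v∈k₂)
      meets⇒InProduct {k₁@(atᴮ _ _)} {idᴮ} valid₁ _ valid = ⨾1'-meets {k₁} valid₁ valid
      meets⇒InProduct {k₁@(Jᴮ _)} {idᴮ} valid₁ _ valid = ⨾1'-meets {k₁} valid₁ valid
      meets⇒InProduct {atᴮ _ _} {atᴮ _ _} {idᴮ} _ _ _ refl (_ , _ , refl , refl , cy) = Cy-1'₃⁻ cy
      meets⇒InProduct {atᴮ _ _} {atᴮ _ _} {atᴮ _ _} _ _ _ refl (_ , _ , refl , refl , cy) =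
        let _ , _ , _ , z≼x⨾y , t = Cy-copies⁻ cy in z≼x⨾y , t
      meets⇒InProduct {atᴮ _ _} {atᴮ _ _} {Jᴮ _} {nothing} _ _ e-div 1'∈J _ = ⊥-elim (1'∉J e-div 1'∈J)
      meets⇒InProduct {atᴮ _ _} {atᴮ _ _} {Jᴮ _} {just _} (_ , i<n) (_ , j<n) e-div z∈J
                      (_ , _ , refl , refl , cy) =
        let x-div , y-div , z-div , z≼x⨾y , t = Cy-copies⁻ cy
            _ , z≼ιe , n≤k = J-copy⁻ z∈J
            cz≡e = c-unique (proj₁ z-div) (proj₁ e-div) z≼ιe
        in subst (E._≼ _) cz≡e (c-⨾ (proj₁ x-div) (proj₁ y-div) (proj₁ z-div) z≼x⨾y) ,
           λ (cx≡e , cy≡e) → ¬T-strict-max (<-≤-trans i<n n≤k) (<-≤-trans j<n n≤k)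
             (t (c≡⇒SameC (proj₁ x-div) (proj₁ y-div) (proj₁ z-div) cx≡e cy≡e cz≡e))
      meets⇒InProduct {atᴮ _ _} {Jᴮ _} valid₁ b-div valid w∈k prod = copy⨾J-meets valid₁ b-div valid w∈k prod
      meets⇒InProduct {Jᴮ _} {atᴮ _ _} a-div valid₂ valid w∈k prod =
        copy⨾J-meets valid₂ a-div valid w∈k (⨾C-comm prod)
      meets⇒InProduct {Jᴮ _} {Jᴮ _} {idᴮ} a-div b-div _ refl prod with J⨾J⁻ a-div b-div prod
      ... | _ , _ , _ , _ , x∈Ja , x∈Jb , cy with Cy-1'₃⁻ cy
      ...   | refl = let x-div , x≼ιa , _ = J-copy⁻ x∈Ja in
                     overlap⇒atom≡ (proj₁ a-div) (proj₁ b-div) (proj₁ (proj₁ x-div))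
                                   x≼ιa (proj₁ (proj₂ (J-copy⁻ x∈Jb)))
      meets⇒InProduct {Jᴮ _} {Jᴮ _} {atᴮ _ _} a-div b-div _ refl prod = J⨾J-meets-copy a-div b-div prod
      meets⇒InProduct {Jᴮ _} {Jᴮ _} {Jᴮ _} {nothing} _ _ e-div 1'∈J _ = ⊥-elim (1'∉J e-div 1'∈J)
      meets⇒InProduct {Jᴮ _} {Jᴮ _} {Jᴮ _} {just _} a-div b-div e-div z∈J prod =
        let z-div , z≼ιe , _ = J-copy⁻ z∈J in
        subst (E._≼ _) (c-unique (proj₁ z-div) (proj₁ e-div) z≼ιe) (J⨾J-meets-copy a-div b-div prod)

      -- Each block meeting the composite of two blocks lies inside it, so composites of joins are joins.
      ⨾-closed : ∀ {X Y} → Joins n X → Joins n Y → Joins n (X ⨾C Y)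
      ⨾-closed {X} {Y} (S₁ , valid₁ , X⊆ , ⊆X) (S₂ , valid₂ , Y⊆ , ⊆Y) =
        Joins-of Produced Produced? proj₁ (⊆Produced , Produced⊆)
        where
          Produced : BIdx → Set
          Produced k = ValidIdx n k × ∃[ k₁ ] (ValidIdx n k₁ × S₁ k₁ ≡ true ×
                                     ∃[ k₂ ] (ValidIdx n k₂ × S₂ k₂ ≡ true × InProduct k₁ k₂ k))
          Produced? : ∀ k → Dec (Produced k)
          Produced? k = ValidIdx? k ×-dec any-valid? (λ k₁ → (S₁ k₁ ≟𝔹 true) ×-dec
                                          any-valid? (λ k₂ → (S₂ k₂ ≟𝔹 true) ×-dec InProduct? k₁ k₂ k))
          ⊆Produced : (X ⨾C Y) ⊆ (λ w → ∃[ k ] (Produced k × elt n k w))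
          ⊆Produced w (u , v , Xu , Yv , cy) =
            let k₁ , s₁ , u∈k₁ = X⊆ u Xu
                k₂ , s₂ , v∈k₂ = Y⊆ v Yv
                k , valid-k , w∈k = block-cover (Cy-valid₃ cy)
            in k , (valid-k , k₁ , valid₁ k₁ s₁ , s₁ , k₂ , valid₂ k₂ s₂ , s₂ ,
                    meets⇒InProduct (valid₁ k₁ s₁) (valid₂ k₂ s₂) valid-k w∈k
                                    (u , v , u∈k₁ , v∈k₂ , cy)) ,
               w∈k
          Produced⊆ : (λ w → ∃[ k ] (Produced k × elt n k w)) ⊆ (X ⨾C Y)
          Produced⊆ w (k , (valid-k , k₁ , valid-k₁ , s₁ , k₂ , valid-k₂ , s₂ , in-product) , w∈k) =
            let u , v , u∈k₁ , v∈k₂ , cy = InProduct⇒⊆ valid-k₁ valid-k₂ valid-k in-product w w∈k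
            in u , v , ⊆X u (k₁ , s₁ , u∈k₁) , ⊆Y v (k₂ , s₂ , v∈k₂) , cy

      subalgebra : IsSubalgebra (Joins n)
      subalgebra = record
        { respects    = Joins-resp-≈
        ; id-closed   = block∈Joins {idᴮ} tt
        ; ∪-closed    = ∪-closed
        ; ∼-closed    = ∼-closed
        ; ⨾-closed    = ⨾-closed
        ; conv-closed = id
        }

lemma4 : (A E : RelAlg) → Finite A → Finite E →
         Symmetric A → Symmetric E → Integral A → Integral E →
         (emb : Embedding E A) → Ext.IsSpecial A E emb →
         (n : ℕ) →
         Ext.IsSubalgebra A E emb (Ext.Joins A E emb n) ×
         (∀ Z → Ext.AtomOf A E emb (Ext.Joins A E emb n) Z → Ext.InB A E emb n Z) ×
         (∀ Z → Ext.InB A E emb n Z → Ext.AtomOf A E emb (Ext.Joins A E emb n) Z)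
lemma4 A E finA finE symA symE _ intE emb special n = subalgebra special , AtomOf⇒InB , InB⇒AtomOf
  where open Extension.Blocks A E finA finE symA symE intE emb n
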